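{- Let $G$ be a group and $H\leq A\leq G$. Then $A$ is a total perfect code of $(G,H)$ if and only if $A$ is a perfect code of $(G,H)$ and there exists an element $x\in N_{A}(H)\setminus H$ such that $x^{2}\in H$.
   Context: All groups are finite. For a group $G$, a subgroup $H\leq G$ and a subset $U\subseteq G$ which is a union of double cosets of $H$ with $H\cap U=\emptyset$ and $U^{ -1}=U$, the coset graph $\mathrm{Cos}(G,H,U)$ has as vertex set the set of left cosets of $H$ in $G$, with $g_1H$ and $g_2H$ adjacent iff $g_1^{ -1}g_2\in U$. A perfect code in a graph is an independent set $C$ of vertices such that every vertex outside $C$ is adjacent to exactly one vertex of $C$; a total perfect code is a set $C$ of vertices such that every vertex is adjacent to exactly one vertex of $C$. For $H\leq A\leq G$, $A$ is called a (total) perfect code of the pair $(G,H)$ if there is a coset graph $\mathrm{Cos}(G,H,U)$ in which the set $\{aH: a\in A\}$ of left cosets of $H$ contained in $A$ is a (total) perfect code. -}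

module Defs where

open import Data.Nat using (ℕ)
open import Data.Fin using (Fin)
open import Data.Fin.Subset using (Subset; _∈_; _∉_)
open import Data.Product using (Σ; _×_; ∃)
open import Relation.Binary.PropositionalEquality using (_≡_)
open import Relation.Nullary using (¬_)
open import Algebra.Structures using (IsGroup)

record FinGroup : Set where
  infixl 7 _∙_
  infix 8 _⁻¹
  field
    n       : ℕ
    _∙_     : Fin n → Fin n → Fin n
    ε       : Fin n
    _⁻¹     : Fin n → Fin n
    isGroup : IsGroup _≡_ _∙_ ε _⁻¹

-- Perfect codes in a graph whose vertices are given by representatives
-- in V, with vertex equality _~_ (an equivalence), adjacency Adj and
-- code C (both compatible with _~_).
module _ {V : Set} (_~_ : V → V → Set) (Adj : V → V → Set) (C : V → Set) where

  ExactlyOneNeighbourIn : V → Set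
  ExactlyOneNeighbourIn v =
    Σ V (λ c → C c × Adj v c × (∀ c' → C c' → Adj v c' → c' ~ c))

  IsIndependent : Set
  IsIndependent = ∀ c c' → C c → C c' → ¬ Adj c c'

  IsPerfectCode : Set
  IsPerfectCode = IsIndependent × (∀ v → ¬ C v → ExactlyOneNeighbourIn v)

  IsTotalPerfectCode : Set
  IsTotalPerfectCode = ∀ v → ExactlyOneNeighbourIn v

module _ (G : FinGroup) where
  open FinGroup G

  IsSubgroup : Subset n → Set
  IsSubgroup H = ε ∈ H
               × (∀ x y → x ∈ H → y ∈ H → x ∙ y ∈ H)
               × (∀ x → x ∈ H → x ⁻¹ ∈ H)

  IsUnionOfDoubleCosets : Subset n → Subset n → Set
  IsUnionOfDoubleCosets H U = ∀ h u h' → h ∈ H → u ∈ U → h' ∈ H → h ∙ u ∙ h' ∈ U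

  IsCosetGraphSet : Subset n → Subset n → Set
  IsCosetGraphSet H U = IsUnionOfDoubleCosets H U
                      × (∀ h → h ∈ H → h ∉ U)
                      × (∀ u → u ∈ U → u ⁻¹ ∈ U)

  -- Vertices of Cos(G,H,U): left cosets gH, represented by g.
  SameCoset : Subset n → Fin n → Fin n → Set
  SameCoset H g g' = g ⁻¹ ∙ g' ∈ H

  CosAdj : Subset n → Fin n → Fin n → Set
  CosAdj U g g' = g ⁻¹ ∙ g' ∈ U

  CosetsIn : Subset n → Subset n → Fin n → Set
  CosetsIn H A g = Σ (Fin n) (λ a → a ∈ A × SameCoset H g a)

  IsPerfectCodeOfPair : Subset n → Subset n → Set
  IsPerfectCodeOfPair H A = Σ (Subset n) λ U →
    IsCosetGraphSet H U × IsPerfectCode (SameCoset H) (CosAdj U) (CosetsIn H A)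

  IsTotalPerfectCodeOfPair : Subset n → Subset n → Set
  IsTotalPerfectCodeOfPair H A = Σ (Subset n) λ U →
    IsCosetGraphSet H U × IsTotalPerfectCode (SameCoset H) (CosAdj U) (CosetsIn H A)

  InNormalizer : Subset n → Subset n → Fin n → Set
  InNormalizer A H x = x ∈ A
                     × (∀ h → h ∈ H → x ∙ h ∙ x ⁻¹ ∈ H)
                     × (∀ h → h ∈ H → x ⁻¹ ∙ h ∙ x ∈ H)

-- Since H ≤ A, the code {aH : a ∈ A} is A itself, and aH is adjacent to bH
-- iff a⁻¹b ∈ U. A total perfect code sees each of its own vertices through a
-- unique neighbour in A: for the vertex H this is xH with x ∈ A ∩ U, and
-- uniqueness forces x⁻¹, h⁻¹x (h ∈ H) into xH, i.e. x² ∈ H and x⁻¹Hx ⊆ H,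
-- while x ∉ H because U ∩ H = ∅. Removing A from U leaves a connection set
-- for which A is a perfect code. Conversely, for such an x the coset xH is a
-- connection set on its own, and adjoining it to a connection set U of a
-- perfect code A gives every vertex aH (a ∈ A) exactly one code neighbour,
-- namely axH, without disturbing the vertices outside A.
module Submission where

open import Defs
open import Algebra.Bundles using (Group)
import Algebra.Properties.Group as GroupProperties
open import Algebra.Structures using (IsGroup)
open import Data.Bool.Properties using (T-≡)
open import Data.Empty using (⊥-elim)
open import Data.Fin using (Fin)
open import Data.Fin.Subset using (Subset; _∈_; _∉_; _⊆_; _∩_; _∪_; ∁)
open import Data.Fin.Subset.Properties
  using (_∈?_; x∈p∩q⁺; x∈p∩q⁻; x∈∁p⇒x∉p; x∉p⇒x∈∁p; x∈p∪q⁺; x∈p∪q⁻)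
open import Data.Product using (Σ; _×_; _,_; proj₁; proj₂)
open import Data.Sum using (_⊎_; inj₁; inj₂)
open import Data.Vec using (tabulate)
open import Data.Vec.Properties using (lookup∘tabulate; lookup⇒[]=; []=⇒lookup)
open import Function.Bundles using (_⇔_; mk⇔; Equivalence)
open import Relation.Binary.PropositionalEquality
open import Relation.Nullary using (¬_; yes; no; isYes)
open import Relation.Nullary.Decidable using (toWitness; fromWitness)

module _ (G : FinGroup) where
  open FinGroup G
  open IsGroup isGroup using (assoc; identityˡ; identityʳ; inverseˡ; _\\_; _//_)

  group : Group _ _
  group = record { isGroup = isGroup }

  open GroupProperties group
    using (ε⁻¹≈ε; ⁻¹-involutive; ⁻¹-anti-homo-∙; ⁻¹-anti-homo-\\;
           \\-leftDividesˡ; \\-leftDividesʳ; //-rightDividesʳ)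
  open ≡-Reasoning

  ε\\x≡x : ∀ x → ε \\ x ≡ x
  ε\\x≡x x = trans (cong (_∙ x) ε⁻¹≈ε) (identityˡ x)

  y∙[x\\y]⁻¹≡x : ∀ x y → y ∙ (x \\ y) ⁻¹ ≡ x
  y∙[x\\y]⁻¹≡x x y = trans (cong (y ∙_) (⁻¹-anti-homo-\\ x y)) (\\-leftDividesˡ y x)

  doubleCoset-cancel : ∀ h u h′ → (h \\ (h ∙ u ∙ h′)) // h′ ≡ u
  doubleCoset-cancel h u h′ = begin
    h ⁻¹ ∙ (h ∙ u ∙ h′) ∙ h′ ⁻¹ ≡⟨ cong (_∙ h′ ⁻¹) (assoc (h ⁻¹) (h ∙ u) h′) ⟨
    h ⁻¹ ∙ (h ∙ u) ∙ h′ ∙ h′ ⁻¹ ≡⟨ //-rightDividesʳ h′ _ ⟩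
    h ⁻¹ ∙ (h ∙ u)              ≡⟨ \\-leftDividesʳ h u ⟩
    u                           ∎

  y∙x∙[x∙x]⁻¹≡y∙x⁻¹ : ∀ x y → y ∙ x ∙ (x ∙ x) ⁻¹ ≡ y ∙ x ⁻¹
  y∙x∙[x∙x]⁻¹≡y∙x⁻¹ x y = begin
    y ∙ x ∙ (x ∙ x) ⁻¹          ≡⟨ cong (y ∙ x ∙_) (⁻¹-anti-homo-∙ x x) ⟩
    y ∙ x ∙ (x ⁻¹ ∙ x ⁻¹)       ≡⟨ assoc y x _ ⟩
    y ∙ (x ∙ (x ⁻¹ ∙ x ⁻¹))     ≡⟨ cong (y ∙_) (\\-leftDividesˡ x (x ⁻¹)) ⟩
    y ∙ x ⁻¹                    ∎

  x⁻¹∙[h∙u∙h′]≡conjugate : ∀ x h u h′ → x ⁻¹ ∙ (h ∙ u ∙ h′) ≡ x ⁻¹ ∙ h ∙ x ∙ (x ⁻¹ ∙ u) ∙ h′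
  x⁻¹∙[h∙u∙h′]≡conjugate x h u h′ = sym (begin
    x ⁻¹ ∙ h ∙ x ∙ (x ⁻¹ ∙ u) ∙ h′   ≡⟨ cong (_∙ h′) (assoc (x ⁻¹ ∙ h) x _) ⟩
    x ⁻¹ ∙ h ∙ (x ∙ (x ⁻¹ ∙ u)) ∙ h′ ≡⟨ cong (λ t → x ⁻¹ ∙ h ∙ t ∙ h′) (\\-leftDividesˡ x u) ⟩
    x ⁻¹ ∙ h ∙ u ∙ h′                ≡⟨ cong (_∙ h′) (assoc (x ⁻¹) h u) ⟩
    x ⁻¹ ∙ (h ∙ u) ∙ h′              ≡⟨ assoc (x ⁻¹) (h ∙ u) h′ ⟩
    x ⁻¹ ∙ (h ∙ u ∙ h′)              ∎)

  x⁻¹∙u⁻¹≡conjugate : ∀ x u → x ⁻¹ ∙ u ⁻¹ ≡ x ⁻¹ ∙ (x ⁻¹ ∙ u) ⁻¹ ∙ x ∙ (x ∙ x) ⁻¹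
  x⁻¹∙u⁻¹≡conjugate x u = sym (begin
    x ⁻¹ ∙ (x ⁻¹ ∙ u) ⁻¹ ∙ x ∙ (x ∙ x) ⁻¹ ≡⟨ y∙x∙[x∙x]⁻¹≡y∙x⁻¹ x _ ⟩
    x ⁻¹ ∙ (x ⁻¹ ∙ u) ⁻¹ ∙ x ⁻¹          ≡⟨ cong (λ t → x ⁻¹ ∙ t ∙ x ⁻¹) (⁻¹-anti-homo-\\ x u) ⟩
    x ⁻¹ ∙ (u ⁻¹ ∙ x) ∙ x ⁻¹             ≡⟨ assoc (x ⁻¹) _ _ ⟩
    x ⁻¹ ∙ (u ⁻¹ ∙ x ∙ x ⁻¹)             ≡⟨ cong (x ⁻¹ ∙_) (//-rightDividesʳ x (u ⁻¹)) ⟩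
    x ⁻¹ ∙ u ⁻¹                          ∎)

  x∙h∙x⁻¹≡conjugate : ∀ x h → x ∙ h ∙ x ⁻¹ ≡ x ∙ x ∙ (x ⁻¹ ∙ h ∙ x) ∙ (x ∙ x) ⁻¹
  x∙h∙x⁻¹≡conjugate x h = sym (begin
    x ∙ x ∙ (x ⁻¹ ∙ h ∙ x) ∙ (x ∙ x) ⁻¹ ≡⟨ cong (_∙ (x ∙ x) ⁻¹) (assoc (x ∙ x) (x ⁻¹ ∙ h) x) ⟨
    x ∙ x ∙ (x ⁻¹ ∙ h) ∙ x ∙ (x ∙ x) ⁻¹ ≡⟨ y∙x∙[x∙x]⁻¹≡y∙x⁻¹ x _ ⟩
    x ∙ x ∙ (x ⁻¹ ∙ h) ∙ x ⁻¹           ≡⟨ cong (_∙ x ⁻¹) (assoc x x (x ⁻¹ ∙ h)) ⟩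
    x ∙ (x ∙ (x ⁻¹ ∙ h)) ∙ x ⁻¹         ≡⟨ cong (λ t → x ∙ t ∙ x ⁻¹) (\\-leftDividesˡ x h) ⟩
    x ∙ h ∙ x ⁻¹                        ∎)

  [x\\[v\\c]]⁻¹≡c\\[v∙x] : ∀ x v c → (x \\ (v \\ c)) ⁻¹ ≡ c \\ (v ∙ x)
  [x\\[v\\c]]⁻¹≡c\\[v∙x] x v c = begin
    (x \\ (v \\ c)) ⁻¹ ≡⟨ ⁻¹-anti-homo-\\ x _ ⟩
    (v \\ c) ⁻¹ ∙ x     ≡⟨ cong (_∙ x) (⁻¹-anti-homo-\\ v c) ⟩
    c ⁻¹ ∙ v ∙ x         ≡⟨ assoc (c ⁻¹) v x ⟩
    c \\ (v ∙ x)         ∎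

  module Subgroup {S : Subset n} (S-subgroup : IsSubgroup G S) where

    ε∈ : ε ∈ S
    ε∈ = proj₁ S-subgroup

    ∙-closed : ∀ {x y} → x ∈ S → y ∈ S → x ∙ y ∈ S
    ∙-closed = proj₁ (proj₂ S-subgroup) _ _

    ⁻¹-closed : ∀ {x} → x ∈ S → x ⁻¹ ∈ S
    ⁻¹-closed = proj₂ (proj₂ S-subgroup) _

    \\-closed : ∀ {x y} → x ∈ S → y ∈ S → x \\ y ∈ S
    \\-closed x∈ y∈ = ∙-closed (⁻¹-closed x∈) y∈

    x\\y∈⇒x∈ : ∀ {x y} → y ∈ S → x \\ y ∈ S → x ∈ S
    x\\y∈⇒x∈ {x} {y} y∈ x\\y∈ = subst (_∈ S) (y∙[x\\y]⁻¹≡x x y) (∙-closed y∈ (⁻¹-closed x\\y∈))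

    x\\y∈⇒y∈ : ∀ {x y} → x ∈ S → x \\ y ∈ S → y ∈ S
    x\\y∈⇒y∈ {x} {y} x∈ x\\y∈ = subst (_∈ S) (\\-leftDividesˡ x y) (∙-closed x∈ x\\y∈)

    ⁻¹∈⇒∈ : ∀ {x} → x ⁻¹ ∈ S → x ∈ S
    ⁻¹∈⇒∈ {x} x⁻¹∈ = subst (_∈ S) (⁻¹-involutive x) (⁻¹-closed x⁻¹∈)

    doubleCoset∈⇒∈ : ∀ {h u h′} → h ∈ S → h′ ∈ S → h ∙ u ∙ h′ ∈ S → u ∈ S
    doubleCoset∈⇒∈ {h} {u} {h′} h∈ h′∈ huh′∈ =
      subst (_∈ S) (doubleCoset-cancel h u h′) (∙-closed (\\-closed h∈ huh′∈) (⁻¹-closed h′∈))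

    x⁻¹Sx⊆S⇒xSx⁻¹⊆S : ∀ {x} → x ∙ x ∈ S → (∀ h → h ∈ S → x ⁻¹ ∙ h ∙ x ∈ S) →
                       ∀ h → h ∈ S → x ∙ h ∙ x ⁻¹ ∈ S
    x⁻¹Sx⊆S⇒xSx⁻¹⊆S {x} x∙x∈ x⁻¹Sx⊆S h h∈ =
      subst (_∈ S) (sym (x∙h∙x⁻¹≡conjugate x h))
        (∙-closed (∙-closed x∙x∈ (x⁻¹Sx⊆S h h∈)) (⁻¹-closed x∙x∈))

  IsSymmetric : Subset n → Set
  IsSymmetric U = ∀ u → u ∈ U → u ⁻¹ ∈ U

  leftCoset : Fin n → Subset n → Subset n
  leftCoset x H = tabulate (λ g → isYes (x \\ g ∈? H))

  ∈-leftCoset⁺ : ∀ {x H g} → x \\ g ∈ H → g ∈ leftCoset x H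
  ∈-leftCoset⁺ {x} {H} {g} x\\g∈H =
    lookup⇒[]= g _ (trans (lookup∘tabulate _ g) (Equivalence.to T-≡ (fromWitness {a? = x \\ g ∈? H} x\\g∈H)))

  ∈-leftCoset⁻ : ∀ {x H g} → g ∈ leftCoset x H → x \\ g ∈ H
  ∈-leftCoset⁻ {x} {H} {g} g∈xH = toWitness {a? = x \\ g ∈? H}
    (Equivalence.from T-≡ (trans (sym (lookup∘tabulate _ g)) ([]=⇒lookup g∈xH)))

  module _ {H : Subset n} where

    ∩-isCosetGraphSet : ∀ {U V} → IsCosetGraphSet G H U →
                        IsUnionOfDoubleCosets G H V → IsSymmetric V →
                        IsCosetGraphSet G H (U ∩ V)
    ∩-isCosetGraphSet {U} {V} (U-doubleCosets , H∩U≡∅ , U-symmetric) V-doubleCosets V-symmetric =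
      doubleCosets , H∩U∩V≡∅ , symmetric
      where
      doubleCosets : IsUnionOfDoubleCosets G H (U ∩ V)
      doubleCosets h u h′ h∈H u∈U∩V h′∈H =
        let u∈U , u∈V = x∈p∩q⁻ U V u∈U∩V
        in x∈p∩q⁺ (U-doubleCosets h u h′ h∈H u∈U h′∈H , V-doubleCosets h u h′ h∈H u∈V h′∈H)

      H∩U∩V≡∅ : ∀ h → h ∈ H → h ∉ U ∩ V
      H∩U∩V≡∅ h h∈H h∈U∩V = H∩U≡∅ h h∈H (proj₁ (x∈p∩q⁻ U V h∈U∩V))

      symmetric : IsSymmetric (U ∩ V)
      symmetric u u∈U∩V =
        let u∈U , u∈V = x∈p∩q⁻ U V u∈U∩V
        in x∈p∩q⁺ (U-symmetric u u∈U , V-symmetric u u∈V)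

    ∪-isCosetGraphSet : ∀ {U V} → IsCosetGraphSet G H U → IsCosetGraphSet G H V →
                        IsCosetGraphSet G H (U ∪ V)
    ∪-isCosetGraphSet {U} {V} (U-doubleCosets , H∩U≡∅ , U-symmetric) (V-doubleCosets , H∩V≡∅ , V-symmetric) =
      doubleCosets , H∩[U∪V]≡∅ , symmetric
      where
      doubleCosets : IsUnionOfDoubleCosets G H (U ∪ V)
      doubleCosets h u h′ h∈H u∈U∪V h′∈H with x∈p∪q⁻ U V u∈U∪V
      ... | inj₁ u∈U = x∈p∪q⁺ (inj₁ (U-doubleCosets h u h′ h∈H u∈U h′∈H))
      ... | inj₂ u∈V = x∈p∪q⁺ (inj₂ (V-doubleCosets h u h′ h∈H u∈V h′∈H))

      H∩[U∪V]≡∅ : ∀ h → h ∈ H → h ∉ U ∪ V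
      H∩[U∪V]≡∅ h h∈H h∈U∪V with x∈p∪q⁻ U V h∈U∪V
      ... | inj₁ h∈U = H∩U≡∅ h h∈H h∈U
      ... | inj₂ h∈V = H∩V≡∅ h h∈H h∈V

      symmetric : IsSymmetric (U ∪ V)
      symmetric u u∈U∪V with x∈p∪q⁻ U V u∈U∪V
      ... | inj₁ u∈U = x∈p∪q⁺ (inj₁ (U-symmetric u u∈U))
      ... | inj₂ u∈V = x∈p∪q⁺ (inj₂ (V-symmetric u u∈V))

  module _ {H A : Subset n} (A-subgroup : IsSubgroup G A) (H⊆A : H ⊆ A) where
    open Subgroup A-subgroup

    ∁-isUnionOfDoubleCosets : IsUnionOfDoubleCosets G H (∁ A)
    ∁-isUnionOfDoubleCosets h u h′ h∈H u∉A h′∈H = x∉p⇒x∈∁p λ huh′∈A →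
      x∈∁p⇒x∉p u∉A (doubleCoset∈⇒∈ (H⊆A h∈H) (H⊆A h′∈H) huh′∈A)

    ∁-isSymmetric : IsSymmetric (∁ A)
    ∁-isSymmetric u u∉A = x∉p⇒x∈∁p λ u⁻¹∈A → x∈∁p⇒x∉p u∉A (⁻¹∈⇒∈ u⁻¹∈A)

  module _ {H : Subset n} (H-subgroup : IsSubgroup G H) {x : Fin n}
           (x⁻¹Hx⊆H : ∀ h → h ∈ H → x ⁻¹ ∙ h ∙ x ∈ H) (x∉H : x ∉ H) (x∙x∈H : x ∙ x ∈ H) where
    open Subgroup H-subgroup

    leftCoset-isCosetGraphSet : IsCosetGraphSet G H (leftCoset x H)
    leftCoset-isCosetGraphSet = doubleCosets , H∩xH≡∅ , symmetric
      where
      doubleCosets : IsUnionOfDoubleCosets G H (leftCoset x H)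
      doubleCosets h u h′ h∈H u∈xH h′∈H = ∈-leftCoset⁺
        (subst (_∈ H) (sym (x⁻¹∙[h∙u∙h′]≡conjugate x h u h′))
          (∙-closed (∙-closed (x⁻¹Hx⊆H h h∈H) (∈-leftCoset⁻ u∈xH)) h′∈H))

      H∩xH≡∅ : ∀ h → h ∈ H → h ∉ leftCoset x H
      H∩xH≡∅ h h∈H h∈xH = x∉H (x\\y∈⇒x∈ h∈H (∈-leftCoset⁻ h∈xH))

      symmetric : IsSymmetric (leftCoset x H)
      symmetric u u∈xH = ∈-leftCoset⁺
        (subst (_∈ H) (sym (x⁻¹∙u⁻¹≡conjugate x u))
          (∙-closed (x⁻¹Hx⊆H _ (⁻¹-closed (∈-leftCoset⁻ u∈xH))) (⁻¹-closed x∙x∈H)))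

  IsInvolutionOfNormalizerQuotient : Subset n → Subset n → Fin n → Set
  IsInvolutionOfNormalizerQuotient A H x = InNormalizer G A H x × x ∉ H × x ∙ x ∈ H

  module _ {H A : Subset n} (H-subgroup : IsSubgroup G H) (A-subgroup : IsSubgroup G A)
           (H⊆A : H ⊆ A) where
    private
      module H = Subgroup H-subgroup
      module A = Subgroup A-subgroup

    inCode⇒∈ : ∀ {g} → CosetsIn G H A g → g ∈ A
    inCode⇒∈ (a , a∈A , g\\a∈H) = A.x\\y∈⇒x∈ a∈A (H⊆A g\\a∈H)

    ∈⇒inCode : ∀ {g} → g ∈ A → CosetsIn G H A g
    ∈⇒inCode {g} g∈A = g , g∈A , subst (_∈ H) (sym (inverseˡ g)) H.ε∈

    totalPerfectCode⇒perfectCode : IsTotalPerfectCodeOfPair G H A → IsPerfectCodeOfPair G H A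
    totalPerfectCode⇒perfectCode (U , U-cosetGraphSet , total) =
      U ∩ ∁ A ,
      ∩-isCosetGraphSet U-cosetGraphSet (∁-isUnionOfDoubleCosets A-subgroup H⊆A) (∁-isSymmetric A-subgroup H⊆A) ,
      independent , perfect
      where
      independent : IsIndependent (SameCoset G H) (CosAdj G (U ∩ ∁ A)) (CosetsIn G H A)
      independent c c′ c∈C c′∈C c\\c′∈U∖A =
        x∈∁p⇒x∉p (proj₂ (x∈p∩q⁻ U (∁ A) c\\c′∈U∖A)) (A.\\-closed (inCode⇒∈ c∈C) (inCode⇒∈ c′∈C))

      perfect : ∀ v → ¬ CosetsIn G H A v →
                ExactlyOneNeighbourIn (SameCoset G H) (CosAdj G (U ∩ ∁ A)) (CosetsIn G H A) v
      perfect v v∉C =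
        let c , c∈C , v\\c∈U , unique = total v
            v\\c∉A = λ v\\c∈A → v∉C (∈⇒inCode (A.x\\y∈⇒x∈ (inCode⇒∈ c∈C) v\\c∈A))
        in c , c∈C , x∈p∩q⁺ (v\\c∈U , x∉p⇒x∈∁p v\\c∉A) ,
           λ c′ c′∈C v\\c′∈U∖A → unique c′ c′∈C (proj₁ (x∈p∩q⁻ U (∁ A) v\\c′∈U∖A))

    module CodeNeighbourOfε (U : Subset n) (U-cosetGraphSet : IsCosetGraphSet G H U)
             (total : IsTotalPerfectCode (SameCoset G H) (CosAdj G U) (CosetsIn G H A)) where
      private
        U-doubleCosets = proj₁ U-cosetGraphSet
        H∩U≡∅          = proj₁ (proj₂ U-cosetGraphSet)
        U-symmetric    = proj₂ (proj₂ U-cosetGraphSet)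

      x : Fin n
      x = proj₁ (total ε)

      x∈A : x ∈ A
      x∈A = inCode⇒∈ (proj₁ (proj₂ (total ε)))

      x∈U : x ∈ U
      x∈U = subst (_∈ U) (ε\\x≡x x) (proj₁ (proj₂ (proj₂ (total ε))))

      c∈A∩U⇒c\\x∈H : ∀ {c} → c ∈ A → c ∈ U → c \\ x ∈ H
      c∈A∩U⇒c\\x∈H {c} c∈A c∈U =
        proj₂ (proj₂ (proj₂ (total ε))) c (∈⇒inCode c∈A) (subst (_∈ U) (sym (ε\\x≡x c)) c∈U)

      x∉H : x ∉ H
      x∉H x∈H = H∩U≡∅ x x∈H x∈U

      x∙x∈H : x ∙ x ∈ H
      x∙x∈H = subst (λ y → y ∙ x ∈ H) (⁻¹-involutive x)
        (c∈A∩U⇒c\\x∈H (A.⁻¹-closed x∈A) (U-symmetric x x∈U))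

      x⁻¹Hx⊆H : ∀ h → h ∈ H → x ⁻¹ ∙ h ∙ x ∈ H
      x⁻¹Hx⊆H h h∈H = subst (_∈ H) (cong (_∙ x) (⁻¹-anti-homo-\\ h x))
        (c∈A∩U⇒c\\x∈H (A.\\-closed (H⊆A h∈H) x∈A) h\\x∈U)
        where
        h\\x∈U : h \\ x ∈ U
        h\\x∈U = subst (_∈ U) (identityʳ _) (U-doubleCosets (h ⁻¹) x ε (H.⁻¹-closed h∈H) x∈U H.ε∈)

    totalPerfectCode⇒involution : IsTotalPerfectCodeOfPair G H A →
                                  Σ (Fin n) (IsInvolutionOfNormalizerQuotient A H)
    totalPerfectCode⇒involution (U , U-cosetGraphSet , total) =
      x , (x∈A , H.x⁻¹Sx⊆S⇒xSx⁻¹⊆S x∙x∈H x⁻¹Hx⊆H , x⁻¹Hx⊆H) , x∉H , x∙x∈H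
      where open CodeNeighbourOfε U U-cosetGraphSet total

    perfectCode⇒totalPerfectCode : IsPerfectCodeOfPair G H A →
                                   Σ (Fin n) (IsInvolutionOfNormalizerQuotient A H) →
                                   IsTotalPerfectCodeOfPair G H A
    perfectCode⇒totalPerfectCode (U , U-cosetGraphSet , independent , perfect)
                                 (x , (x∈A , _ , x⁻¹Hx⊆H) , x∉H , x∙x∈H) =
      U ∪ xH , ∪-isCosetGraphSet U-cosetGraphSet (leftCoset-isCosetGraphSet H-subgroup x⁻¹Hx⊆H x∉H x∙x∈H) ,
      total
      where
      xH = leftCoset x H

      ExactlyOneCodeNeighbour : Fin n → Set
      ExactlyOneCodeNeighbour = ExactlyOneNeighbourIn (SameCoset G H) (CosAdj G (U ∪ xH)) (CosetsIn G H A)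

      ∈U∪xH⁻ : ∀ {u} → u ∈ U ∪ xH → u ∈ U ⊎ x \\ u ∈ H
      ∈U∪xH⁻ u∈U∪xH with x∈p∪q⁻ U xH u∈U∪xH
      ... | inj₁ u∈U  = inj₁ u∈U
      ... | inj₂ u∈xH = inj₂ (∈-leftCoset⁻ u∈xH)

      neighbourOfCode : ∀ {v} → v ∈ A → ExactlyOneCodeNeighbour v
      neighbourOfCode {v} v∈A = v ∙ x , ∈⇒inCode (A.∙-closed v∈A x∈A) , x∈p∪q⁺ (inj₂ (∈-leftCoset⁺ x\\[v\\vx]∈H)) , unique
        where
        x\\[v\\vx]∈H : x \\ (v \\ (v ∙ x)) ∈ H
        x\\[v\\vx]∈H = subst (_∈ H) (sym (trans (cong (x \\_) (\\-leftDividesʳ v x)) (inverseˡ x))) H.ε∈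

        unique : ∀ c′ → CosetsIn G H A c′ → v \\ c′ ∈ U ∪ xH → c′ \\ (v ∙ x) ∈ H
        unique c′ c′∈C v\\c′∈U∪xH with ∈U∪xH⁻ v\\c′∈U∪xH
        ... | inj₁ v\\c′∈U     = ⊥-elim (independent v c′ (∈⇒inCode v∈A) c′∈C v\\c′∈U)
        ... | inj₂ x\\[v\\c′]∈H = subst (_∈ H) ([x\\[v\\c]]⁻¹≡c\\[v∙x] x v c′) (H.⁻¹-closed x\\[v\\c′]∈H)

      neighbourOutsideCode : ∀ {v} → v ∉ A → ExactlyOneCodeNeighbour v
      neighbourOutsideCode {v} v∉A =
        let c , c∈C , v\\c∈U , unique = perfect v (λ v∈C → v∉A (inCode⇒∈ v∈C))
        in c , c∈C , x∈p∪q⁺ (inj₁ v\\c∈U) , unique′ unique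
        where
        unique′ : ∀ {c} → (∀ c′ → CosetsIn G H A c′ → v \\ c′ ∈ U → c′ \\ c ∈ H) →
                  ∀ c′ → CosetsIn G H A c′ → v \\ c′ ∈ U ∪ xH → c′ \\ c ∈ H
        unique′ unique c′ c′∈C v\\c′∈U∪xH with ∈U∪xH⁻ v\\c′∈U∪xH
        ... | inj₁ v\\c′∈U     = unique c′ c′∈C v\\c′∈U
        ... | inj₂ x\\[v\\c′]∈H =
          ⊥-elim (v∉A (A.x\\y∈⇒x∈ (inCode⇒∈ c′∈C) (A.x\\y∈⇒y∈ x∈A (H⊆A x\\[v\\c′]∈H))))

      total : IsTotalPerfectCode (SameCoset G H) (CosAdj G (U ∪ xH)) (CosetsIn G H A)
      total v with v ∈? A
      ... | yes v∈A = neighbourOfCode v∈A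
      ... | no v∉A  = neighbourOutsideCode v∉A

lemma2p4 : (G : FinGroup) → (H A : Subset (FinGroup.n G)) →
    IsSubgroup G H → IsSubgroup G A → H ⊆ A →
    IsTotalPerfectCodeOfPair G H A
    ⇔ (IsPerfectCodeOfPair G H A
    × Σ (Fin (FinGroup.n G)) (λ x → InNormalizer G A H x × x ∉ H × FinGroup._∙_ G x x ∈ H))
lemma2p4 G H A H-subgroup A-subgroup H⊆A = mk⇔
  (λ total → totalPerfectCode⇒perfectCode G H-subgroup A-subgroup H⊆A total ,
             totalPerfectCode⇒involution G H-subgroup A-subgroup H⊆A total)
  (λ (perfect , involution) → perfectCode⇒totalPerfectCode G H-subgroup A-subgroup H⊆A perfect involution)
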